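{- Let $L$ be an $\alpha$-sorted lattice data structure of height $h$ and $K$ a positive integer. (1) If $K$ is a proper key of $L$ and the last movement in the search path of $K$ ends on diagonal $s$ with $s<\alpha+2$, then $J(K)\le 2$. (2) If $K$ is not a proper key of $L$ and the last movement in the search path of $K$ ends on diagonal $s$ with $s<\alpha+1$, then $J(K)\le 4$.
   Context: Diagram of height $h$: cells $(r,c)$ of positive integers with $r+c\le h+4$; $r$ is the row (numbered bottom to top), $c$ the column (left to right). Diagonal $k$ ($1\le k\le h+3$) is the set of cells with $r+c=k+1$, numbered from head $(k,1)$ to tail $(1,k)$, its $j$-th cell being $(k+1-j,j)$. A lattice data structure (LDS) of height $h$ assigns to each cell an entry in $\{0,\infty\}\cup\mathbb{Z}_{>0}$ such that: (1) all cells of row $1$ and column $1$ contain $0$; (2) all cells of diagonal $h+3$ except head and tail contain $\infty$; (3) for some $0\le m\le h-1$, exactly the cells $(h+3-j,j)$ of diagonal $h+2$ with $h+2-m\le j\le h+1$ contain $\infty$; (4) all remaining cells contain pairwise distinct positive integers (proper keys); (5) proper keys are strictly increasing along each row (left to right), column (bottom to top) and diagonal (head to tail). Order convention: $0<n<\infty$. For a cell $C=(r,c)$: $D=(r-1,c)$, $DR=(r-1,c+1)$. SearchLDS($L,K$): start at $(h+1,2)$; repeatedly: entry $=K$ → stop; entry $=0$ → stop; else move to $DR$ (a "$d$" movement) if $K>$ entry, to $D$ (a "$D$" movement) if $K<$ entry. The search path of $K$ is the sequence of movements made until termination; the jump factor $J(K)$ is the number of maximal blocks of consecutive identical movements in the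 search path. For $\alpha\in\{3,\dots,h\}$, $L$ is $\alpha$-sorted if for every $s$ with $4\le s\le\alpha+2$, the first proper key of diagonal $s$ (the proper key in the lowest-numbered cell from the head) is greater than the last proper key of diagonal $s-1$. -}

module Defs where

open import Data.Nat using (ℕ; zero; suc; _+_; _∸_; _≤_; _<_; _≡ᵇ_; _<ᵇ_)
open import Data.Bool using (Bool; true; false; if_then_else_)
open import Data.List using (List; []; _∷_; map; upTo; reverse)
open import Data.Maybe using (Maybe; just; nothing)
open import Data.Product using (_×_; _,_; Σ; ∃; proj₁; proj₂)
open import Data.Sum using (_⊎_)
open import Relation.Binary.PropositionalEquality using (_≡_)
open import Relation.Nullary using (¬_)

data Entry : Set where
  zer : Entry
  inf : Entry
  key : ℕ → Entry

-- A labelling of cells (r , c) (row r, column c); only diagram cells matter.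
Labelling : Set
Labelling = ℕ → ℕ → Entry

InDiagram : ℕ → ℕ → ℕ → Set
InDiagram h r c = 1 ≤ r × 1 ≤ c × r + c ≤ h + 4

record IsLDS (h : ℕ) (L : Labelling) : Set where
  field
    row1 : ∀ c → InDiagram h 1 c → L 1 c ≡ zer
    col1 : ∀ r → InDiagram h r 1 → L r 1 ≡ zer
    -- (2) diagonal h+3: cell j is (h+4-j , j); all except head and tail are ∞
    diagTop : ∀ j → 2 ≤ j → j ≤ h + 2 → L (h + 4 ∸ j) j ≡ inf
    -- (3) diagonal h+2: cell j is (h+3-j , j)
    m : ℕ
    m≤h-1 : m ≤ h ∸ 1
    diagInf : ∀ j → h + 2 ∸ m ≤ j → j ≤ h + 1 → L (h + 3 ∸ j) j ≡ inf
    remaining : ∀ r c → 2 ≤ r → 2 ≤ c → r + c ≤ h + 2 ⊎ (r + c ≡ h + 3 × c < h + 2 ∸ m) →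
                Σ ℕ λ k → 1 ≤ k × L r c ≡ key k
    distinct : ∀ r c r' c' k → InDiagram h r c → InDiagram h r' c' →
               L r c ≡ key k → L r' c' ≡ key k → r ≡ r' × c ≡ c'
    rowInc : ∀ r c c' k k' → InDiagram h r c → InDiagram h r c' → c < c' →
             L r c ≡ key k → L r c' ≡ key k' → k < k'
    colInc : ∀ r r' c k k' → InDiagram h r c → InDiagram h r' c → r < r' →
             L r c ≡ key k → L r' c ≡ key k' → k < k'
    -- cells (r , c) and (r' , c') on the same diagonal, c < c' (i.e. head to tail)
    diagInc : ∀ r c r' c' k k' → InDiagram h r c → InDiagram h r' c' →
              r + c ≡ r' + c' → c < c' →
              L r c ≡ key k → L r' c' ≡ key k' → k < k'

IsProperKey : ℕ → Labelling → ℕ → Set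
IsProperKey h L K = ∃ λ r → ∃ λ c → InDiagram h r c × L r c ≡ key K

-- Entries of diagonal k, from head (cell j = 1) to tail (cell j = k): cell j is (k+1-j , j).
diagEntries : Labelling → ℕ → List Entry
diagEntries L k = map (λ j → L (k + 1 ∸ j) j) (map suc (upTo k))

firstKey : List Entry → Maybe ℕ
firstKey [] = nothing
firstKey (key k ∷ _) = just k
firstKey (_ ∷ es) = firstKey es

lastKey : List Entry → Maybe ℕ
lastKey es = firstKey (reverse es)

IsSorted : ℕ → Labelling → Set
IsSorted α L = ∀ s → 4 ≤ s → s ≤ α + 2 → ∀ a b →
  firstKey (diagEntries L s) ≡ just a → lastKey (diagEntries L (s ∸ 1)) ≡ just b → b < a

-- Movements: d = move to DR, D = move to D
data Move : Set where
  d : Move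
  D : Move

sameMove : Move → Move → Bool
sameMove d d = true
sameMove D D = true
sameMove _ _ = false

-- Rows strictly decrease, so recursion on the row; row 0 is never reached in an LDS
-- (row 1 contains 0 and stops the search).
searchFrom : Labelling → ℕ → ℕ → ℕ → List Move × (ℕ × ℕ)
searchFrom L K zero c = [] , (zero , c)
searchFrom L K (suc r) c with L (suc r) c
... | zer = [] , (suc r , c)
... | inf = let p = searchFrom L K r c in (D ∷ proj₁ p) , proj₂ p
... | key k = if K ≡ᵇ k then ([] , (suc r , c))
              else (if k <ᵇ K
                    then (let p = searchFrom L K r (suc c) in (d ∷ proj₁ p) , proj₂ p)
                    else (let p = searchFrom L K r c in (D ∷ proj₁ p) , proj₂ p))

search : ℕ → Labelling → ℕ → List Move × (ℕ × ℕ)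
search h L K = searchFrom L K (h + 1) 2

searchPath : ℕ → Labelling → ℕ → List Move
searchPath h L K = proj₁ (search h L K)

-- diagonal of the cell where the search terminates (= where the last movement ends);
-- cell (r , c) lies on diagonal r + c - 1
endDiagonal : ℕ → Labelling → ℕ → ℕ
endDiagonal h L K = proj₁ (proj₂ (search h L K)) + proj₂ (proj₂ (search h L K)) ∸ 1

changes : Move → List Move → ℕ
changes x [] = 0
changes x (y ∷ ys) = (if sameMove x y then 0 else 1) + changes y ys

blocks : List Move → ℕ
blocks [] = 0
blocks (x ∷ xs) = suc (changes x xs)

jumpFactor : ℕ → Labelling → ℕ → ℕ
jumpFactor h L K = blocks (searchPath h L K)

-- The search first descends column 2 past ∞ entries and keys larger than K.  In the
-- α-sorted region every key of a diagonal is smaller than every key of the next one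
-- (the last key of a diagonal sits in row 2, the first in column 2), and above that
-- region column 2 keeps increasing.  If K is a proper key, the search finds it (K always
-- stays weakly right of the current column and on or below the current diagonal), so
-- when K lies in the sorted region the search descends column 2 exactly to K's diagonal
-- and then moves right along it: D…D d…d.  Otherwise, consider the first right turn, at a
-- column-2 key k < K.  If k lies above the sorted region, all keys of the sorted region
-- are below K and the search cannot end below diagonal α + 1.  If k lies inside it,
-- all keys on lower diagonals are below k < K, so after the turn the search drops at most
-- once and then only moves right: D…D d…d D d…d.
module Submission where

open import Defs
open import Data.Nat using (ℕ; zero; suc; _+_; _∸_; _≤_; _<_; _≡ᵇ_; _<ᵇ_; z≤n; s≤s)
open import Data.Nat.Properties
open import Data.Bool using (true; false; T)
open import Data.List using (List; []; _∷_; map; reverse; upTo; downFrom)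
open import Data.List.Properties using (reverse-map; reverse-upTo)
open import Data.Maybe using (just)
open import Data.Product using (_×_; _,_; proj₁; proj₂; ∃)
open import Data.Sum using (_⊎_; inj₁; inj₂)
open import Relation.Nullary using (¬_; yes; no)
open import Data.Unit using (tt)
open import Data.Empty using (⊥; ⊥-elim)
open import Relation.Binary.PropositionalEquality
open import Function using (_∘_)

flipMove : Move → Move
flipMove d = D
flipMove D = d

-- p consists of at most n alternating blocks, the first (possibly empty) one made of x's.
data Runs : ℕ → Move → List Move → Set where
  done   : ∀ {n x} → Runs n x []
  stay   : ∀ {n x p} → Runs (suc n) x p → Runs (suc n) x (x ∷ p)
  switch : ∀ {n x p} → Runs n (flipMove x) p → Runs (suc n) x p

changes≤1+changes : ∀ x y p → changes x p ≤ suc (changes y p)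
changes≤1+changes x y [] = z≤n
changes≤1+changes d d (z ∷ p) = n≤1+n _
changes≤1+changes D D (z ∷ p) = n≤1+n _
changes≤1+changes d D (d ∷ p) = m≤n⇒m≤1+n (n≤1+n _)
changes≤1+changes d D (D ∷ p) = ≤-refl
changes≤1+changes D d (d ∷ p) = ≤-refl
changes≤1+changes D d (D ∷ p) = m≤n⇒m≤1+n (n≤1+n _)

Runs⇒changes≤ : ∀ {n x p} → Runs (suc n) x p → changes x p ≤ n
Runs⇒changes≤ done = z≤n
Runs⇒changes≤ {x = d} (stay r) = Runs⇒changes≤ r
Runs⇒changes≤ {x = D} (stay r) = Runs⇒changes≤ r
Runs⇒changes≤ {zero} (switch done) = z≤n
Runs⇒changes≤ {suc n} {x} {p} (switch r) = ≤-trans (changes≤1+changes x (flipMove x) p) (s≤s (Runs⇒changes≤ r))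

Runs⇒blocks≤ : ∀ {n x p} → Runs n x p → blocks p ≤ n
Runs⇒blocks≤ done = z≤n
Runs⇒blocks≤ (stay r) = s≤s (Runs⇒changes≤ r)
Runs⇒blocks≤ (switch r) = m≤n⇒m≤1+n (Runs⇒blocks≤ r)

data Search (L : Labelling) (K : ℕ) : ℕ → ℕ → List Move → ℕ × ℕ → Set where
  bottom   : ∀ {c} → Search L K zero c [] (zero , c)
  empty    : ∀ {r c} → L (suc r) c ≡ zer → Search L K (suc r) c [] (suc r , c)
  found    : ∀ {r c} → L (suc r) c ≡ key K → Search L K (suc r) c [] (suc r , c)
  down-inf : ∀ {r c p e} → L (suc r) c ≡ inf → Search L K r c p e → Search L K (suc r) c (D ∷ p) e
  down-key : ∀ {r c p e k} → L (suc r) c ≡ key k → K < k → Search L K r c p e → Search L K (suc r) c (D ∷ p) e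
  right    : ∀ {r c p e k} → L (suc r) c ≡ key k → k < K → Search L K r (suc c) p e → Search L K (suc r) c (d ∷ p) e

searchFrom-Search : ∀ L K r c → Search L K r c (proj₁ (searchFrom L K r c)) (proj₂ (searchFrom L K r c))
searchFrom-Search L K zero c = bottom
searchFrom-Search L K (suc r) c with L (suc r) c in eq
... | zer = empty eq
... | inf = down-inf eq (searchFrom-Search L K r c)
... | key k with K ≡ᵇ k in eqK
...   | true rewrite ≡ᵇ⇒≡ K k (subst T (sym eqK) tt) = found eq
...   | false with k <ᵇ K in lt
...     | true = right eq (<ᵇ⇒< k K (subst T (sym lt) tt)) (searchFrom-Search L K r (suc c))
...     | false = down-key eq (≤∧≢⇒< (≮⇒≥ (λ k<K → subst T lt (<⇒<ᵇ k<K)))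
                                    (λ K≡k → subst T eqK (≡⇒≡ᵇ K k K≡k)))
                              (searchFrom-Search L K r c)

zer≢key : ∀ {k} → zer ≢ key k
zer≢key ()

inf≢key : ∀ {k} → inf ≢ key k
inf≢key ()

key-injective : ∀ {a b} → key a ≡ key b → a ≡ b
key-injective refl = refl

firstKey-zer-key : ∀ {x y es a} → x ≡ zer → y ≡ key a → firstKey (x ∷ y ∷ es) ≡ just a
firstKey-zer-key refl refl = refl

firstKey-diagEntries : ∀ (L : Labelling) t {a} → L (3 + t) 1 ≡ zer → L (2 + t) 2 ≡ key a →
                       firstKey (diagEntries L (3 + t)) ≡ just a
firstKey-diagEntries L t {a} z e =
  firstKey-zer-key (subst (λ n → L (2 + n) 1 ≡ zer) (+-comm 1 t) z)
                   (subst (λ n → L (1 + n) 2 ≡ key a) (+-comm 1 t) e)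

lastKey-diagEntries : ∀ (L : Labelling) t {b} → L 1 (3 + t) ≡ zer → L 2 (2 + t) ≡ key b →
                      lastKey (diagEntries L (3 + t)) ≡ just b
lastKey-diagEntries L t {b} z e =
  trans (cong firstKey reversed)
        (firstKey-zer-key (subst (λ n → L n (3 + t) ≡ zer) (sym (m+n∸m≡n t 1)) z)
                          (subst (λ n → L n (2 + t) ≡ key b) (sym row≡2) e))
  where
  cell : ℕ → Entry
  cell j = L (3 + t + 1 ∸ j) j
  reversed : reverse (diagEntries L (3 + t)) ≡ map cell (map suc (downFrom (3 + t)))
  reversed = begin
    reverse (map cell (map suc (upTo (3 + t))))  ≡⟨ reverse-map cell (map suc (upTo (3 + t))) ⟨
    map cell (reverse (map suc (upTo (3 + t))))  ≡⟨ cong (map cell) (reverse-map suc (upTo (3 + t))) ⟨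
    map cell (map suc (reverse (upTo (3 + t))))  ≡⟨ cong (map cell ∘ map suc) (reverse-upTo (3 + t)) ⟩
    map cell (map suc (downFrom (3 + t)))        ∎
    where open ≡-Reasoning
  row≡2 : suc (t + 1) ∸ t ≡ 2
  row≡2 = trans (cong (_∸ t) (sym (+-suc t 1))) (m+n∸m≡n t 2)

module Geometry {h : ℕ} {L : Labelling} (lds : IsLDS h L) where
  open IsLDS lds

  h+3≡1+[h+2] : h + 3 ≡ suc (h + 2)
  h+3≡1+[h+2] = +-suc h 2

  h+4≡1+[h+3] : h + 4 ≡ suc (h + 3)
  h+4≡1+[h+3] = +-suc h 3

  ≤-cancel-2 : ∀ {r c n} → 2 ≤ r → r + c ≤ 2 + n → c ≤ n
  ≤-cancel-2 {r} {c} {n} r≥2 s≤ = +-cancelˡ-≤ 2 c n (≤-trans (+-monoˡ-≤ c r≥2) s≤)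

  row1≡zer : ∀ {c} → 1 ≤ c → 1 + c ≤ h + 4 → L 1 c ≡ zer
  row1≡zer {c} c≥1 s≤ = row1 c (≤-refl , c≥1 , s≤)

  key⇒2≤row : ∀ {r c k} → InDiagram h r c → L r c ≡ key k → 2 ≤ r
  key⇒2≤row {suc zero} {c} (_ , c≥1 , s≤) e with () ← trans (sym (row1≡zer c≥1 s≤)) e
  key⇒2≤row {suc (suc r)} _ _ = s≤s (s≤s z≤n)

  key⇒2≤col : ∀ {r c k} → InDiagram h r c → L r c ≡ key k → 2 ≤ c
  key⇒2≤col {r} {suc zero} i e with () ← trans (sym (col1 r i)) e
  key⇒2≤col {r} {suc (suc c)} _ _ = s≤s (s≤s z≤n)

  KeyRegion : ℕ → ℕ → Set
  KeyRegion r c = r + c ≤ h + 2 ⊎ (r + c ≡ h + 3 × c < h + 2 ∸ m)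

  InfRegion : ℕ → ℕ → Set
  InfRegion r c = (r + c ≡ h + 3 × h + 2 ∸ m ≤ c) ⊎ r + c ≡ h + 4

  KeyRegion⇒key : ∀ {r c} → 2 ≤ r → 2 ≤ c → KeyRegion r c → ∃ λ k → L r c ≡ key k
  KeyRegion⇒key r≥2 c≥2 reg = let k , _ , e = remaining _ _ r≥2 c≥2 reg in k , e

  InfRegion⇒inf : ∀ {r c} → 2 ≤ r → 2 ≤ c → InfRegion r c → L r c ≡ inf
  InfRegion⇒inf {r} {c} r≥2 c≥2 (inj₁ (s≡ , c≥)) =
    subst (λ x → L x c ≡ inf) (trans (cong (_∸ c) (sym s≡)) (m+n∸n≡m r c))
      (diagInf c c≥ (≤-cancel-2 r≥2 (≤-reflexive (trans s≡ (trans h+3≡1+[h+2] (cong suc (+-suc h 1)))))))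
  InfRegion⇒inf {r} {c} r≥2 c≥2 (inj₂ s≡) =
    subst (λ x → L x c ≡ inf) (trans (cong (_∸ c) (sym s≡)) (m+n∸n≡m r c))
      (diagTop c c≥2 (≤-cancel-2 r≥2 (≤-reflexive (trans s≡ (trans h+4≡1+[h+3] (cong suc h+3≡1+[h+2]))))))

  key-or-inf : ∀ {r c} → 2 ≤ r → 2 ≤ c → r + c ≤ h + 4 → (∃ λ k → L r c ≡ key k) ⊎ InfRegion r c
  key-or-inf {r} {c} r≥2 c≥2 s≤ with r + c ≤? h + 2
  ... | yes s≤h+2 = inj₁ (KeyRegion⇒key r≥2 c≥2 (inj₁ s≤h+2))
  ... | no s≰h+2 with r + c ≟ h + 3
  ...   | yes s≡h+3 with c <? h + 2 ∸ m
  ...     | yes c< = inj₁ (KeyRegion⇒key r≥2 c≥2 (inj₂ (s≡h+3 , c<)))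
  ...     | no c≮ = inj₂ (inj₁ (s≡h+3 , ≮⇒≥ c≮))
  key-or-inf {r} {c} r≥2 c≥2 s≤ | no s≰h+2 | no s≢h+3 =
    inj₂ (inj₂ (≤-antisym s≤ (subst (_≤ r + c) (sym h+4≡1+[h+3]) (≤∧≢⇒< h+3≤s (s≢h+3 ∘ sym)))))
    where
    h+3≤s : h + 3 ≤ r + c
    h+3≤s = subst (_≤ r + c) (sym h+3≡1+[h+2]) (≰⇒> s≰h+2)

  inner≢zer : ∀ {r c} → 2 ≤ r → 2 ≤ c → r + c ≤ h + 4 → L r c ≢ zer
  inner≢zer r≥2 c≥2 s≤ e with key-or-inf r≥2 c≥2 s≤
  ... | inj₁ (k , e′) with () ← trans (sym e) e′
  ... | inj₂ reg with () ← trans (sym e) (InfRegion⇒inf r≥2 c≥2 reg)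

  inf⇒InfRegion : ∀ {r c} → 2 ≤ c → InDiagram h r c → L r c ≡ inf → InfRegion r c
  inf⇒InfRegion {suc zero} c≥2 (_ , c≥1 , s≤) e with () ← trans (sym e) (row1≡zer c≥1 s≤)
  inf⇒InfRegion {suc (suc r)} c≥2 (_ , _ , s≤) e with key-or-inf (s≤s (s≤s z≤n)) c≥2 s≤
  ... | inj₁ (k , e′) with () ← trans (sym e) e′
  ... | inj₂ reg = reg

  InfRegion⇒h+3≤ : ∀ {r c} → InfRegion r c → h + 3 ≤ r + c
  InfRegion⇒h+3≤ (inj₁ (s≡ , _)) = ≤-reflexive (sym s≡)
  InfRegion⇒h+3≤ (inj₂ s≡) = subst (h + 3 ≤_) (sym s≡) (subst (h + 3 ≤_) (sym h+4≡1+[h+3]) (n≤1+n _))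

  inf⇒h+3≤ : ∀ {r c} → 2 ≤ c → InDiagram h r c → L r c ≡ inf → h + 3 ≤ r + c
  inf⇒h+3≤ c≥2 i e = InfRegion⇒h+3≤ (inf⇒InfRegion c≥2 i e)

  key⇒≤h+3 : ∀ {r c k} → InDiagram h r c → L r c ≡ key k → r + c ≤ h + 3
  key⇒≤h+3 {r} {c} i e with m≤n⇒m<n∨m≡n (proj₂ (proj₂ i))
  ... | inj₁ s< = ≤-pred (subst (r + c <_) h+4≡1+[h+3] s<)
  ... | inj₂ s≡ with () ← trans (sym e) (InfRegion⇒inf (key⇒2≤row i e) (key⇒2≤col i e) (inj₂ s≡))

  inf⇒no-key-beyond : ∀ {r c r′ c′ k} → 2 ≤ c → InDiagram h r c → L r c ≡ inf →
                      1 ≤ r′ → r′ + c′ ≡ r + c → c ≤ c′ → L r′ c′ ≢ key k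
  inf⇒no-key-beyond {r} {c} {suc zero} c≥2 (_ , _ , s≤) _ _ s≡ c≤c′ e′ =
    zer≢key (trans (sym (row1≡zer (<⇒≤ (≤-trans c≥2 c≤c′)) (subst (_≤ h + 4) (sym s≡) s≤))) e′)
  inf⇒no-key-beyond {r} {c} {suc (suc r′)} {c′} c≥2 i e _ s≡ c≤c′ e′ =
    inf≢key (trans (sym (InfRegion⇒inf (s≤s (s≤s z≤n)) (≤-trans c≥2 c≤c′) (beyond (inf⇒InfRegion c≥2 i e)))) e′)
    where
    beyond : InfRegion r c → InfRegion (suc (suc r′)) c′
    beyond (inj₁ (s≡′ , c≥)) = inj₁ (trans s≡ s≡′ , ≤-trans c≥ c≤c′)
    beyond (inj₂ s≡′) = inj₂ (trans s≡ s≡′)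

  key-at : ∀ {r c} → 2 ≤ r → 2 ≤ c → r + c ≤ h + 2 → ∃ λ k → L r c ≡ key k
  key-at r≥2 c≥2 s≤ = KeyRegion⇒key r≥2 c≥2 (inj₁ s≤)

  key-at-col2 : 1 ≤ h → ∀ {r} → 2 ≤ r → r + 2 ≤ h + 3 → ∃ λ k → L r 2 ≡ key k
  key-at-col2 h≥1 {r} r≥2 s≤ with r + 2 ≤? h + 2
  ... | yes s≤h+2 = key-at r≥2 ≤-refl s≤h+2
  ... | no s≰h+2 = KeyRegion⇒key r≥2 ≤-refl (inj₂ (s≡h+3 , 2<h+2∸m))
    where
    s≡h+3 : r + 2 ≡ h + 3
    s≡h+3 = ≤-antisym s≤ (subst (_≤ r + 2) (sym h+3≡1+[h+2]) (≰⇒> s≰h+2))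
    2<h+2∸m : 2 < h + 2 ∸ m
    2<h+2∸m = m+n≤o⇒m≤o∸n 3
      (subst (3 + m ≤_) (trans (cong (2 +_) (m+[n∸m]≡n h≥1)) (+-comm 2 h)) (+-monoʳ-≤ 3 m≤h-1))

  diag-≤ : ∀ {r c r′ c′ k k′} → InDiagram h r c → InDiagram h r′ c′ → r + c ≡ r′ + c′ → c ≤ c′ →
           L r c ≡ key k → L r′ c′ ≡ key k′ → k ≤ k′
  diag-≤ {r} {c} {r′} i i′ s≡ c≤c′ e e′ with m≤n⇒m<n∨m≡n c≤c′
  ... | inj₁ c<c′ = <⇒≤ (diagInc _ _ _ _ _ _ i i′ s≡ c<c′ e e′)
  ... | inj₂ refl with +-cancelʳ-≡ c r r′ s≡
  ...   | refl = ≤-reflexive (key-injective (trans (sym e) e′))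

  col-≤ : ∀ {r r′ c k k′} → InDiagram h r c → InDiagram h r′ c → r ≤ r′ →
          L r c ≡ key k → L r′ c ≡ key k′ → k ≤ k′
  col-≤ i i′ r≤r′ e e′ with m≤n⇒m<n∨m≡n r≤r′
  ... | inj₁ r<r′ = <⇒≤ (colInc _ _ _ _ _ i i′ r<r′ e e′)
  ... | inj₂ refl = ≤-reflexive (key-injective (trans (sym e) e′))

  h+2≤h+4 : h + 2 ≤ h + 4
  h+2≤h+4 = +-monoʳ-≤ h (s≤s (s≤s z≤n))

  h+3≤h+4 : h + 3 ≤ h + 4
  h+3≤h+4 = +-monoʳ-≤ h (s≤s (s≤s (s≤s z≤n)))

  inner : ∀ {r c} → 2 ≤ r → 2 ≤ c → r + c ≤ h + 4 → InDiagram h r c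
  inner r≥2 c≥2 s≤ = <⇒≤ r≥2 , <⇒≤ c≥2 , s≤

  on-diagram : ∀ {r c} → 2 ≤ c → suc r + c ≤ h + 4 → InDiagram h (suc r) c
  on-diagram c≥2 s≤ = s≤s z≤n , <⇒≤ c≥2 , s≤

module Sorted {h : ℕ} {L : Labelling} (lds : IsLDS h L)
              {α : ℕ} (α≥1 : 1 ≤ α) (α≤h : α ≤ h) (sorted : IsSorted α L) where
  open IsLDS lds
  open Geometry lds

  h≥1 : 1 ≤ h
  h≥1 = ≤-trans α≥1 α≤h

  α+2≤h+2 : α + 2 ≤ h + 2
  α+2≤h+2 = +-monoˡ-≤ 2 α≤h

  α+3≤h+3 : α + 3 ≤ h + 3
  α+3≤h+3 = +-monoˡ-≤ 3 α≤h

  sorted-step : ∀ t {a b} → 4 + t ≤ α + 2 → L 2 (2 + t) ≡ key b → L (3 + t) 2 ≡ key a → b < a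
  sorted-step t {a} {b} s≤ eb ea =
    sorted (4 + t) (s≤s (s≤s (s≤s (s≤s z≤n)))) s≤ a b
      (firstKey-diagEntries L (1 + t) (col1 (4 + t) (s≤s z≤n , ≤-refl , subst (_≤ h + 4) (+-comm 1 (4 + t)) 5+t≤h+4)) ea)
      (lastKey-diagEntries L t (row1 (3 + t) (≤-refl , s≤s z≤n , ≤-trans (≤-trans s≤ α+2≤h+2) h+2≤h+4)) eb)
    where
    5+t≤h+4 : 5 + t ≤ h + 4
    5+t≤h+4 = ≤-trans (subst (5 + t ≤_) (sym (+-suc α 2)) (s≤s s≤)) (≤-trans α+3≤h+3 h+3≤h+4)

  -- Cells are compared through r + c, the diagonal number plus one.  The chain is
  -- k ≤ (key at (2 , 2 + t)) < (key at (3 + t , 2)) ≤ (key at (2 + t′ , 2)) ≤ k′.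
  sorted-< : ∀ {r c r′ c′ k k′} → 2 ≤ r → 2 ≤ c → 2 ≤ r′ → 2 ≤ c′ → r + c < r′ + c′ → r′ + c′ ≤ α + 3 →
             L r c ≡ key k → L r′ c′ ≡ key k′ → k < k′
  sorted-< {suc (suc i)} {suc (suc j)} {suc (suc i′)} {suc (suc j′)} {k} {k′}
           (s≤s (s≤s z≤n)) (s≤s (s≤s z≤n)) (s≤s (s≤s z≤n)) (s≤s (s≤s z≤n)) s<s′ s′≤ e e′ =
    let b , eb = key-at ≤-refl (m≤m+n 2 t) 4+t≤h+2
        a , ea = key-at-col2 h≥1 (m≤m+n 2 (1 + t)) [3+t]+2≤h+3
        a′ , ea′ = key-at-col2 h≥1 (m≤m+n 2 t′) [2+t′]+2≤h+3
    in begin-strict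
      k   ≤⟨ diag-≤ (inner (m≤m+n 2 i) (m≤m+n 2 j) (subst (_≤ h + 4) (sym sum≡) (≤-trans 4+t≤h+2 h+2≤h+4)))
                    (inner ≤-refl (m≤m+n 2 t) (≤-trans 4+t≤h+2 h+2≤h+4))
                    sum≡ (s≤s (s≤s (m≤n+m j i))) e eb ⟩
      b   <⟨ sorted-step t 4+t≤α+2 eb ea ⟩
      a   ≤⟨ col-≤ (inner (m≤m+n 2 (1 + t)) ≤-refl (≤-trans [3+t]+2≤h+3 h+3≤h+4))
                   (inner (m≤m+n 2 t′) ≤-refl (≤-trans [2+t′]+2≤h+3 h+3≤h+4))
                   (s≤s (s≤s t<t′)) ea ea′ ⟩
      a′  ≤⟨ diag-≤ (inner (m≤m+n 2 t′) ≤-refl (≤-trans [2+t′]+2≤h+3 h+3≤h+4))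
                    (inner (m≤m+n 2 i′) (m≤m+n 2 j′) (≤-trans s′≤ (≤-trans α+3≤h+3 h+3≤h+4)))
                    (trans (+-comm (2 + t′) 2) (sym sum≡′)) (m≤m+n 2 j′) ea′ e′ ⟩
      k′  ∎
    where
    open ≤-Reasoning
    t = i + j
    t′ = i′ + j′
    sum≡ : 2 + i + (2 + j) ≡ 4 + t
    sum≡ = cong (2 +_) (trans (+-suc i (suc j)) (cong suc (+-suc i j)))
    sum≡′ : 2 + i′ + (2 + j′) ≡ 4 + t′
    sum≡′ = cong (2 +_) (trans (+-suc i′ (suc j′)) (cong suc (+-suc i′ j′)))
    t<t′ : t < t′
    t<t′ = +-cancelˡ-< 4 t t′ (subst₂ _<_ sum≡ sum≡′ s<s′)
    4+t′≤α+3 : 4 + t′ ≤ α + 3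
    4+t′≤α+3 = subst (_≤ α + 3) sum≡′ s′≤
    4+t≤α+2 : 4 + t ≤ α + 2
    4+t≤α+2 = ≤-pred (subst (5 + t ≤_) (+-suc α 2) (≤-trans (+-monoʳ-≤ 4 t<t′) 4+t′≤α+3))
    4+t≤h+2 : 4 + t ≤ h + 2
    4+t≤h+2 = ≤-trans 4+t≤α+2 α+2≤h+2
    [3+t]+2≤h+3 : 3 + t + 2 ≤ h + 3
    [3+t]+2≤h+3 = subst (_≤ h + 3) (+-comm 2 (3 + t))
                    (≤-trans (subst (5 + t ≤_) (sym (+-suc α 2)) (s≤s 4+t≤α+2)) α+3≤h+3)
    [2+t′]+2≤h+3 : 2 + t′ + 2 ≤ h + 3
    [2+t′]+2≤h+3 = subst (_≤ h + 3) (+-comm 2 (2 + t′)) (≤-trans 4+t′≤α+3 α+3≤h+3)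

  sorted-<-column2 : ∀ {r₀ c₀ r k₀ k} → 2 ≤ r₀ → 2 ≤ c₀ → r₀ + c₀ ≤ α + 2 → r₀ + c₀ < r + 2 → r + 2 ≤ h + 3 →
                     L r₀ c₀ ≡ key k₀ → L r 2 ≡ key k → k₀ < k
  sorted-<-column2 {r₀} {c₀} {r} r₀≥2 c₀≥2 s₀≤ s₀< s≤ e₀ e with r + 2 ≤? α + 3
  ... | yes s≤α+3 = sorted-< r₀≥2 c₀≥2 r≥2 ≤-refl s₀< s≤α+3 e₀ e
    where
    r≥2 : 2 ≤ r
    r≥2 = +-cancelʳ-≤ 2 2 r (≤-trans (≤-trans (+-mono-≤ r₀≥2 c₀≥2) (n≤1+n _)) s₀<)
  ... | no s≰α+3 =
    -- k₀ < (key at (α + 1 , 2)) ≤ k, going up column 2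
    let a , ea = key-at-col2 h≥1 α+1≥2 (≤-trans [α+1]+2≤α+3 α+3≤h+3) in
    <-≤-trans (sorted-< r₀≥2 c₀≥2 α+1≥2 ≤-refl (subst (r₀ + c₀ <_) (sym (trans (+-assoc α 1 2) (+-suc α 2))) (s≤s s₀≤)) [α+1]+2≤α+3 e₀ ea)
              (col-≤ (inner α+1≥2 ≤-refl (≤-trans (≤-trans [α+1]+2≤α+3 α+3≤h+3) h+3≤h+4))
                     on-column2 α+1≤r ea e)
    where
    α+1≥2 : 2 ≤ α + 1
    α+1≥2 = subst (2 ≤_) (+-comm 1 α) (s≤s α≥1)
    [α+1]+2≤α+3 : α + 1 + 2 ≤ α + 3
    [α+1]+2≤α+3 = ≤-reflexive (+-assoc α 1 2)
    α+1≤r : α + 1 ≤ r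
    α+1≤r = +-cancelʳ-≤ 2 (α + 1) r (subst (_≤ r + 2) (sym (+-assoc α 1 2)) (<⇒≤ (≰⇒> s≰α+3)))
    on-column2 : InDiagram h r 2
    on-column2 = inner (≤-trans α+1≥2 α+1≤r) ≤-refl (≤-trans s≤ h+3≤h+4)

module Correctness {h : ℕ} {L : Labelling} (lds : IsLDS h L) (K : ℕ) where
  open Geometry lds

  Bounded : ℕ → ℕ → Set
  Bounded r c = ∀ {r′ c′} → InDiagram h r′ c′ → L r′ c′ ≡ key K → c ≤ c′ × r′ + c′ ≤ r + c

  Bounded-start : Bounded (h + 1) 2
  Bounded-start {r′} {c′} i e = key⇒2≤col i e , subst (r′ + c′ ≤_) (sym (+-assoc h 1 2)) (key⇒≤h+3 i e)

  Bounded⇒2≤row : ∀ {r c} → Bounded r c → IsProperKey h L K → 2 ≤ r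
  Bounded⇒2≤row {r} {c} bounded (r′ , c′ , i , e) =
    let c≤c′ , s≤ = bounded i e in
    +-cancelʳ-≤ c 2 r (≤-trans (+-mono-≤ (key⇒2≤row i e) c≤c′) s≤)

  Bounded-down : ∀ {r c} → Bounded (suc r) c →
                 (∀ {r′ c′} → InDiagram h r′ c′ → L r′ c′ ≡ key K → c ≤ c′ → r′ + c′ ≢ suc r + c) →
                 Bounded r c
  Bounded-down bounded off-diagonal i e =
    let c≤c′ , s≤ = bounded i e in c≤c′ , ≤-pred (≤∧≢⇒< s≤ (off-diagonal i e c≤c′))

  Bounded-right : ∀ {r c} → Bounded (suc r) c →
                  (∀ {r′} → InDiagram h r′ c → L r′ c ≡ key K → r′ ≤ suc r → ⊥) →
                  Bounded r (suc c)
  Bounded-right {r} {c} bounded off-column {r′} {c′} i e with bounded i e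
  ... | c≤c′ , s≤ with m≤n⇒m<n∨m≡n c≤c′
  ...   | inj₁ c<c′ = c<c′ , subst (r′ + c′ ≤_) (sym (+-suc r c)) s≤
  ...   | inj₂ refl = ⊥-elim (off-column i e (+-cancelʳ-≤ c r′ (suc r) s≤))

  search-finds : ∀ {r c p re ce} → Search L K r c p (re , ce) → 2 ≤ c → r + c ≤ h + 3 → Bounded r c →
                 IsProperKey h L K → InDiagram h re ce × L re ce ≡ key K
  search-finds s c≥2 s≤ bounded pk with Bounded⇒2≤row bounded pk
  search-finds bottom c≥2 s≤ bounded pk | ()
  search-finds (empty e) c≥2 s≤ bounded pk | r≥2 =
    ⊥-elim (inner≢zer r≥2 c≥2 (≤-trans s≤ h+3≤h+4) e)
  search-finds (found e) c≥2 s≤ bounded pk | _ = on-diagram c≥2 (≤-trans s≤ h+3≤h+4) , e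
  search-finds {suc r} {c} (down-inf e s) c≥2 s≤ bounded pk | r≥2 =
    search-finds s c≥2 (≤-trans (n≤1+n _) s≤) (Bounded-down bounded off-diagonal) pk
    where
    off-diagonal : ∀ {r′ c′} → InDiagram h r′ c′ → L r′ c′ ≡ key K → c ≤ c′ → r′ + c′ ≢ suc r + c
    off-diagonal i e′ c≤c′ s≡ = inf⇒no-key-beyond c≥2 (on-diagram c≥2 (≤-trans s≤ h+3≤h+4)) e (proj₁ i) s≡ c≤c′ e′
  search-finds {suc r} {c} (down-key e K<k s) c≥2 s≤ bounded pk | r≥2 =
    search-finds s c≥2 (≤-trans (n≤1+n _) s≤) (Bounded-down bounded off-diagonal) pk
    where
    off-diagonal : ∀ {r′ c′} → InDiagram h r′ c′ → L r′ c′ ≡ key K → c ≤ c′ → r′ + c′ ≢ suc r + c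
    off-diagonal i e′ c≤c′ s≡ = <⇒≱ K<k (diag-≤ (on-diagram c≥2 (≤-trans s≤ h+3≤h+4)) i (sym s≡) c≤c′ e e′)
  search-finds {suc r} {c} (right e k<K s) c≥2 s≤ bounded pk | r≥2 =
    search-finds s (≤-trans c≥2 (n≤1+n _)) (subst (_≤ h + 3) (sym (+-suc r c)) s≤)
      (Bounded-right bounded off-column) pk
    where
    off-column : ∀ {r′} → InDiagram h r′ c → L r′ c ≡ key K → r′ ≤ suc r → ⊥
    off-column i e′ r′≤ = <⇒≱ k<K (col-≤ i (on-diagram c≥2 (≤-trans s≤ h+3≤h+4)) r′≤ e′ e)

module KeyInSortedRegion {h : ℕ} {L : Labelling} (lds : IsLDS h L)
                           {α : ℕ} (α≥1 : 1 ≤ α) (α≤h : α ≤ h) (sorted : IsSorted α L)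
                           {K re ce : ℕ} (i : InDiagram h re ce) (eK : L re ce ≡ key K) (s≤ : re + ce ≤ α + 2) where
  open Geometry lds
  open Sorted lds α≥1 α≤h sorted

  along-diagonal : ∀ {r c p e} → Search L K r c p e → 2 ≤ c → r + c ≡ re + ce → c ≤ ce → Runs 1 d p
  along-diagonal bottom _ _ _ = done
  along-diagonal (empty _) _ _ _ = done
  along-diagonal (found _) _ _ _ = done
  along-diagonal (down-inf e _) c≥2 s≡ c≤ce =
    ⊥-elim (inf⇒no-key-beyond c≥2 (on-diagram c≥2 (subst (_≤ h + 4) (sym s≡) (proj₂ (proj₂ i)))) e (proj₁ i) (sym s≡) c≤ce eK)
  along-diagonal (down-key e K<k _) c≥2 s≡ c≤ce =
    ⊥-elim (<⇒≱ K<k (diag-≤ (on-diagram c≥2 (subst (_≤ h + 4) (sym s≡) (proj₂ (proj₂ i)))) i s≡ c≤ce e eK))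
  along-diagonal {suc r} {c} (right e k<K s) c≥2 s≡ c≤ce with m≤n⇒m<n∨m≡n c≤ce
  ... | inj₁ c<ce = stay (along-diagonal s (≤-trans c≥2 (n≤1+n c)) (trans (+-suc r c) s≡) c<ce)
  ... | inj₂ refl with +-cancelʳ-≡ c (suc r) re s≡
  ...   | refl = ⊥-elim (<-irrefl (key-injective (trans (sym e) eK)) k<K)

  column-descent : ∀ {r p e} → Search L K r 2 p e → re + ce ≤ r + 2 → r + 2 ≤ h + 3 → Runs 2 D p
  column-descent bottom _ _ = done
  column-descent {suc r} s lo hi with m≤n⇒m<n∨m≡n lo
  ... | inj₂ s≡ = switch (along-diagonal s ≤-refl (sym s≡) (key⇒2≤col i eK))
  column-descent (empty _) _ _ | inj₁ _ = done
  column-descent (found _) _ _ | inj₁ _ = done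
  column-descent (down-inf _ s) _ hi | inj₁ s< = stay (column-descent s (≤-pred s<) (≤-trans (n≤1+n _) hi))
  column-descent (down-key _ _ s) _ hi | inj₁ s< = stay (column-descent s (≤-pred s<) (≤-trans (n≤1+n _) hi))
  column-descent (right e k<K _) _ hi | inj₁ s< =
    ⊥-elim (<-asym k<K (sorted-<-column2 (key⇒2≤row i eK) (key⇒2≤col i eK) s≤ s< hi eK e))

module SearchInSortedRegion {h : ℕ} {L : Labelling} (lds : IsLDS h L)
                         {α : ℕ} (α≥1 : 1 ≤ α) (α≤h : α ≤ h) (sorted : IsSorted α L) (K : ℕ) where
  open Geometry lds
  open Sorted lds α≥1 α≤h sorted

  below-h+3 : ∀ {n} → n ≤ h + 2 → n < h + 3
  below-h+3 {n} n≤ = subst (n <_) (sym h+3≡1+[h+2]) (s≤s n≤)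

  Below : ℕ → Set
  Below n = ∀ {r c k} → 2 ≤ r → 2 ≤ c → r + c < n → L r c ≡ key k → k < K

  rightward : ∀ {r c p e} → Search L K r c p e → 2 ≤ c → r + c ≤ h + 2 → Below (suc (r + c)) → Runs 1 d p
  rightward bottom _ _ _ = done
  rightward (empty _) _ _ _ = done
  rightward (found _) _ _ _ = done
  rightward (down-inf e _) c≥2 s≤ _ = ⊥-elim (<⇒≱ (below-h+3 s≤) (inf⇒h+3≤ c≥2 (on-diagram c≥2 (≤-trans s≤ h+2≤h+4)) e))
  rightward (down-key e K<k _) c≥2 s≤ below = ⊥-elim (<-asym K<k (below (key⇒2≤row (on-diagram c≥2 (≤-trans s≤ h+2≤h+4)) e) c≥2 ≤-refl e))
  rightward {suc r} {c} (right _ _ s) c≥2 s≤ below =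
    stay (rightward s (≤-trans c≥2 (n≤1+n c)) (subst (_≤ h + 2) (sym (+-suc r c)) s≤)
                      (subst Below (cong suc (sym (+-suc r c))) below))

  rightward-one-drop : ∀ {r c p e} → Search L K r c p e → 2 ≤ c → r + c ≤ h + 2 → Below (r + c) → Runs 3 d p
  rightward-one-drop bottom _ _ _ = done
  rightward-one-drop (empty _) _ _ _ = done
  rightward-one-drop (found _) _ _ _ = done
  rightward-one-drop (down-inf e _) c≥2 s≤ _ = ⊥-elim (<⇒≱ (below-h+3 s≤) (inf⇒h+3≤ c≥2 (on-diagram c≥2 (≤-trans s≤ h+2≤h+4)) e))
  rightward-one-drop (down-key _ _ s) c≥2 s≤ below =
    switch (stay (switch (rightward s c≥2 (≤-trans (n≤1+n _) s≤) below)))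
  rightward-one-drop {suc r} {c} (right _ _ s) c≥2 s≤ below =
    stay (rightward-one-drop s (≤-trans c≥2 (n≤1+n c)) (subst (_≤ h + 2) (sym (+-suc r c)) s≤)
                           (subst Below (sym (+-suc r c)) below))

  never-enters-sorted-region : ∀ {r c p re ce} → Search L K r c p (re , ce) → 2 ≤ c → α + 2 ≤ r + c → r + c ≤ h + 4 →
           Below (α + 3) → α + 2 ≤ re + ce
  never-enters-sorted-region bottom _ lo _ _ = lo
  never-enters-sorted-region (empty _) _ lo _ _ = lo
  never-enters-sorted-region (found _) _ lo _ _ = lo
  never-enters-sorted-region {suc r} {c} (down-inf e s) c≥2 lo hi below =
    never-enters-sorted-region s c≥2 (≤-trans α+2≤h+2 (≤-pred (subst (_≤ suc r + c) h+3≡1+[h+2] (inf⇒h+3≤ c≥2 (on-diagram c≥2 hi) e))))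
           (≤-trans (n≤1+n _) hi) below
  never-enters-sorted-region (down-key e K<k s) c≥2 lo hi below with m≤n⇒m<n∨m≡n lo
  ... | inj₁ α+2< = never-enters-sorted-region s c≥2 (≤-pred α+2<) (≤-trans (n≤1+n _) hi) below
  ... | inj₂ α+2≡ = ⊥-elim (<-asym K<k (below (key⇒2≤row (on-diagram c≥2 hi) e) c≥2
                                               (subst (_< α + 3) α+2≡ (+-monoʳ-< α ≤-refl)) e))
  never-enters-sorted-region {suc r} {c} (right _ _ s) c≥2 lo hi below =
    never-enters-sorted-region s (≤-trans c≥2 (n≤1+n c)) (subst (α + 2 ≤_) (sym (+-suc r c)) lo) (subst (_≤ h + 4) (sym (+-suc r c)) hi) below

  column-descent : ∀ {r p re ce} → Search L K r 2 p (re , ce) → r + 2 ≤ h + 3 → re + ce ≤ α + 1 → Runs 4 D p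
  column-descent bottom _ _ = done
  column-descent (empty _) _ _ = done
  column-descent (found _) _ _ = done
  column-descent (down-inf _ s) hi end = stay (column-descent s (≤-trans (n≤1+n _) hi) end)
  column-descent (down-key _ _ s) hi end = stay (column-descent s (≤-trans (n≤1+n _) hi) end)
  column-descent {suc r} t@(right e k<K s) hi end with suc r + 2 ≤? α + 2
  ... | yes s≤α+2 = switch (rightward-one-drop t ≤-refl (≤-trans s≤α+2 α+2≤h+2) below)
    where
    below : Below (suc r + 2)
    below r′≥2 c′≥2 s′< e′ =
      <-trans (sorted-< r′≥2 c′≥2 (key⇒2≤row (on-diagram ≤-refl (≤-trans hi h+3≤h+4)) e) ≤-refl s′<
                        (≤-trans s≤α+2 (+-monoʳ-≤ α (n≤1+n 2))) e′ e) k<K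
  ... | no s≰α+2 =
    ⊥-elim (<⇒≱ (+-monoʳ-< α ≤-refl)
                (≤-trans (never-enters-sorted-region s (s≤s (s≤s z≤n)) α+2≤r+3 (≤-trans (≤-reflexive (+-suc r 2)) (≤-trans hi h+3≤h+4)) below) end))
    where
    α+2<s : α + 2 < suc r + 2
    α+2<s = ≰⇒> s≰α+2
    α+2≤r+3 : α + 2 ≤ r + 3
    α+2≤r+3 = ≤-trans (≤-pred α+2<s) (+-monoʳ-≤ r (n≤1+n 2))
    below : Below (α + 3)
    below {r′} {c′} r′≥2 c′≥2 s′< e′ =
      let s′≤α+2 = ≤-pred (subst (r′ + c′ <_) (+-suc α 2) s′<) in
      <-trans (sorted-<-column2 r′≥2 c′≥2 s′≤α+2 (≤-<-trans s′≤α+2 α+2<s) hi e′ e) k<K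

m∸1<n⇒m≤n : ∀ {m n} → m ∸ 1 < n → m ≤ n
m∸1<n⇒m≤n {zero} _ = z≤n
m∸1<n⇒m≤n {suc m} m<n = m<n

lemma3 : (h α : ℕ) (L : Labelling) → IsLDS h L → 3 ≤ α → α ≤ h → IsSorted α L →
         (K : ℕ) → 1 ≤ K →
         ((IsProperKey h L K → endDiagonal h L K < α + 2 → jumpFactor h L K ≤ 2) ×
          (¬ IsProperKey h L K → endDiagonal h L K < α + 1 → jumpFactor h L K ≤ 4))
lemma3 h α L lds α≥3 α≤h sorted K _ = proper , not-proper
  where
  α≥1 : 1 ≤ α
  α≥1 = ≤-trans (s≤s z≤n) α≥3
  search-path : Search L K (h + 1) 2 (searchPath h L K) (proj₂ (search h L K))
  search-path = searchFrom-Search L K (h + 1) 2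
  start : h + 1 + 2 ≤ h + 3
  start = ≤-reflexive (+-assoc h 1 2)

  proper : IsProperKey h L K → endDiagonal h L K < α + 2 → jumpFactor h L K ≤ 2
  proper pk end =
    let i , eK = Correctness.search-finds lds K search-path ≤-refl start (Correctness.Bounded-start lds K) pk
        end≤α+2 = m∸1<n⇒m≤n end
    in Runs⇒blocks≤ (KeyInSortedRegion.column-descent lds α≥1 α≤h sorted i eK end≤α+2 search-path
                       (≤-trans end≤α+2 (+-monoˡ-≤ 2 (≤-trans α≤h (m≤m+n h 1)))) start)

  -- The bound holds for every K.
  not-proper : ¬ IsProperKey h L K → endDiagonal h L K < α + 1 → jumpFactor h L K ≤ 4
  not-proper _ end = Runs⇒blocks≤ (SearchInSortedRegion.column-descent lds α≥1 α≤h sorted K search-path start (m∸1<n⇒m≤n end))
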